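{- Let $G$ be an irreflexive oriented graph whose underlying graph has maximum degree at most 3, and run the Consistency Check Algorithm on $G$. (1) If $t_0$ is removed from $\ell(y)$ during the algorithm, then either there is a vertex $x$ with $\ell(x)=\{t_0\}$ (at some point of the algorithm) and a $(0,1)$-walk from $x$ to $y$, or there is a vertex $x$ with $\ell(x)=\{t_1\}$ and a $(1,1)$-walk from $x$ to $y$. (2) If $t_1$ is removed from $\ell(y)$ during the algorithm, then either there is a vertex $x$ with $\ell(x)=\{t_0\}$ and a $(0,0)$-walk from $x$ to $y$, or there is a vertex $x$ with $\ell(x)=\{t_1\}$ and a $(1,0)$-walk from $x$ to $y$.
   Context: Consistency Check Algorithm on an oriented graph $G$ with arc set $E$: each vertex $x$ gets a list $\ell(x)\subseteq\{t_0,t_1\}$, initialized to $\{t_0\}$ if $x$ has out-degree 2, to $\{t_1\}$ if $x$ has in-degree 2, and to $\{t_0,t_1\}$ otherwise. Then repeat until some list becomes empty or no list changes: (1) if $\ell(y)=\{t_0\}$ and $xy\in E$, remove $t_1$ from $\ell(x)$; (2) if $\ell(y)=\{t_1\}$ and $yx\in E$, remove $t_0$ from $\ell(x)$; (3) if $\ell(y)=\{c\}$ and, for some $s$, either $xs,ys\in E$ or $sx,sy\in E$ ($x\ne y$), remove $c$ from $\ell(x)$. Walks. A walk in $G$ is a sequence of vertices $x=u_0,\dots,u_m=y$ with consecutive vertices joined by an arc; the arc is forwards if it is $u_iu_{i+1}$, backwards if $u_{i+1}u_i$. The walk splits into maximal same-direction segments, forwards segments $F_i$ and backwards segments $B_j$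 (directed paths in $G$), alternating; every segment other than the first and last has length at least 2, first and last have length at least 1, $k\ge1$. - $(1,0)$-walk from $x$ to $y$: a copy of $H_3^c$ with arcs $sx,sy$, or $F_1,B_1,\dots,F_k,B_k$. - $(0,1)$-walk from $x$ to $y$: a copy of $H_3$ with arcs $xz,yz$, or $B_1,F_1,\dots,B_k,F_k$. - $(0,0)$-walk: $B_1,F_1,\dots,F_{k-1},B_k$. - $(1,1)$-walk: $F_1,B_1,\dots,B_{k-1},F_k$. -}

module Defs where

open import Data.Nat using (ℕ; zero; suc; _+_; _≤_; _<_; _≡ᵇ_)
open import Data.Fin using (Fin; zero; suc; _≟_)
open import Data.Bool using (Bool; true; false; if_then_else_; _∧_; _∨_)
open import Data.Product using (Σ; _×_; _,_)
open import Data.Sum using (_⊎_)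
open import Relation.Nullary using (¬_; does)
open import Relation.Binary.PropositionalEquality using (_≡_; _≢_)

Arcs : ℕ → Set
Arcs n = Fin n → Fin n → Bool

count : ∀ {n} → (Fin n → Bool) → ℕ
count {zero}  f = 0
count {suc n} f = (if f zero then 1 else 0) + count (λ i → f (suc i))

outdeg : ∀ {n} → Arcs n → Fin n → ℕ
outdeg E x = count (λ z → E x z)

indeg : ∀ {n} → Arcs n → Fin n → ℕ
indeg E x = count (λ z → E z x)

deg : ∀ {n} → Arcs n → Fin n → ℕ
deg E x = count (λ z → E x z ∨ E z x)

Irreflexive : ∀ {n} → Arcs n → Set
Irreflexive E = ∀ x → E x x ≡ false

Oriented : ∀ {n} → Arcs n → Set
Oriented E = ∀ x y → E x y ≡ true → E y x ≡ false

MaxDeg≤3 : ∀ {n} → Arcs n → Set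
MaxDeg≤3 E = ∀ x → deg E x ≤ 3

data Label : Set where
  t0 t1 : Label

_==L_ : Label → Label → Bool
t0 ==L t0 = true
t1 ==L t1 = true
_  ==L _  = false

other : Label → Label
other t0 = t1
other t1 = t0

-- a state assigns to each vertex a list ℓ(x) ⊆ {t0,t1}, given by membership
State : ℕ → Set
State n = Fin n → Label → Bool

Singleton : ∀ {n} → State n → Fin n → Label → Set
Singleton ℓ y c = (ℓ y c ≡ true) × (ℓ y (other c) ≡ false)

AllNonempty : ∀ {n} → State n → Set
AllNonempty ℓ = ∀ x → (ℓ x t0 ∨ ℓ x t1) ≡ true

initState : ∀ {n} → Arcs n → State n
initState E x c =
  if outdeg E x ≡ᵇ 2 then (c ==L t0)
  else if indeg E x ≡ᵇ 2 then (c ==L t1)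
  else true

remove : ∀ {n} → State n → Fin n → Label → State n
remove ℓ x c x' c' = if does (x ≟ x') ∧ (c ==L c') then false else ℓ x' c'

data Trigger {n} (E : Arcs n) (ℓ : State n) : Fin n → Label → Set where
  rule1 : ∀ {x} y → Singleton ℓ y t0 → E x y ≡ true → Trigger E ℓ x t1
  rule2 : ∀ {x} y → Singleton ℓ y t1 → E y x ≡ true → Trigger E ℓ x t0
  rule3 : ∀ {x c} y s → x ≢ y → Singleton ℓ y c →
          ((E x s ≡ true × E y s ≡ true) ⊎ (E s x ≡ true × E s y ≡ true)) →
          Trigger E ℓ x c

-- one step of the algorithm: all lists nonempty (else it has stopped),
-- some c ∈ ℓ(x) is removed by one of the rules, nothing else changes.
Step : ∀ {n} → Arcs n → State n → State n → Set
Step {n} E ℓ ℓ' =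
  AllNonempty ℓ ×
  Σ (Fin n) λ x → Σ Label λ c →
    (ℓ x c ≡ true) × Trigger E ℓ x c ×
    (∀ x' c' → ℓ' x' c' ≡ remove ℓ x c x' c')

-- σ 0, …, σ m is a run (prefix of an execution) of the algorithm
IsRun : ∀ {n} → Arcs n → (ℕ → State n) → ℕ → Set
IsRun E σ m =
  (∀ x c → σ 0 x c ≡ initState E x c) ×
  (∀ j → j < m → Step E (σ j) (σ (suc j)))

data DPath {n} (E : Arcs n) : Fin n → Fin n → ℕ → Set where
  arc : ∀ {u v} → E u v ≡ true → DPath E u v 1
  _∷_ : ∀ {u w v k} → E u w ≡ true → DPath E w v k → DPath E u v (suc k)

data Dir : Set where
  fwd bwd : Dir

flipD : Dir → Dir
flipD fwd = bwd
flipD bwd = fwd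

Seg : ∀ {n} → Arcs n → Dir → Fin n → Fin n → ℕ → Set
Seg E fwd x y k = DPath E x y k
Seg E bwd x y k = DPath E y x k

data Tail {n} (E : Arcs n) : Dir → Dir → Fin n → Fin n → Set where
  last : ∀ {d z y k} → Seg E d z y k → Tail E d d z y
  more : ∀ {d e z w y k} → Seg E d z w k → 2 ≤ k →
         Tail E (flipD d) e w y → Tail E d e z y

-- walk from x to y split into maximal alternating segments, first with
-- direction d, last with direction e
AltWalk : ∀ {n} → Arcs n → Dir → Dir → Fin n → Fin n → Set
AltWalk {n} E d e x y =
  ((d ≡ e) × Σ ℕ λ k → Seg E d x y k) ⊎
  (Σ (Fin n) λ w → Σ ℕ λ k → Seg E d x w k × Tail E (flipD d) e w y)

H3c : ∀ {n} → Arcs n → Fin n → Fin n → Set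
H3c {n} E x y = (x ≢ y) × Σ (Fin n) λ s → (E s x ≡ true) × (E s y ≡ true)

H3 : ∀ {n} → Arcs n → Fin n → Fin n → Set
H3 {n} E x y = (x ≢ y) × Σ (Fin n) λ z → (E x z ≡ true) × (E y z ≡ true)

Walk10 Walk01 Walk00 Walk11 : ∀ {n} → Arcs n → Fin n → Fin n → Set
Walk10 E x y = H3c E x y ⊎ AltWalk E fwd bwd x y
Walk01 E x y = H3 E x y ⊎ AltWalk E bwd fwd x y
Walk00 E x y = AltWalk E bwd bwd x y
Walk11 E x y = AltWalk E fwd fwd x y

module Submission where

-- Every removal is justified by one of the three rules, and the witness of the
-- rule already yields the required walk: rules (1) and (2) give a walk of a
-- single arc, and rule (3) gives either a copy of H₃ / H₃ᶜ or a walk made of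
-- two segments of length one through the common neighbour s.

open import Defs
open import Data.Nat using (ℕ; _≤_; _<_; suc)
open import Data.Nat.Properties using (<⇒≤)
open import Data.Fin using (Fin; _≟_)
open import Data.Bool using (true; false)
open import Data.Product using (Σ; _×_; _,_)
open import Data.Sum using (_⊎_; inj₁; inj₂)
import Data.Sum as Sum
open import Relation.Nullary using (yes; no)
open import Relation.Binary.PropositionalEquality using (_≡_; _≢_; refl; sym; trans)

remove-changes-only : ∀ {n} (ℓ : State n) x c y d →
  ℓ y d ≡ true → remove ℓ x c y d ≡ false → (x ≡ y) × (c ≡ d)
remove-changes-only ℓ x c y d d∈ℓy d∉ℓ'y with x ≟ y | c | d
... | yes x≡y | t0 | t0 = x≡y , refl
... | yes x≡y | t1 | t1 = x≡y , refl
... | yes _   | t0 | t1 with () ← trans (sym d∈ℓy) d∉ℓ'y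
... | yes _   | t1 | t0 with () ← trans (sym d∈ℓy) d∉ℓ'y
... | no _    | _  | _  with () ← trans (sym d∈ℓy) d∉ℓ'y

step-removal-triggered : ∀ {n} {E : Arcs n} {ℓ ℓ' : State n} {y c} →
  Step E ℓ ℓ' → ℓ y c ≡ true → ℓ' y c ≡ false → Trigger E ℓ y c
step-removal-triggered {ℓ = ℓ} {y = y} {c} (_ , x , d , _ , trigger , ℓ'≡) c∈ℓy c∉ℓ'y
  with remove-changes-only ℓ x d y c c∈ℓy (trans (sym (ℓ'≡ y c)) c∉ℓ'y)
... | refl , refl = trigger

segment-walk : ∀ {n} {E : Arcs n} {d x y k} → Seg E d x y k → AltWalk E d d x y
segment-walk seg = inj₁ (refl , _ , seg)

two-segment-walk : ∀ {n} {E : Arcs n} {d x w y k k'} →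
  Seg E d x w k → Seg E (flipD d) w y k' → AltWalk E d (flipD d) x y
two-segment-walk seg seg' = inj₂ (_ , _ , seg , last seg')

≢-sym : ∀ {n} {x y : Fin n} → x ≢ y → y ≢ x
≢-sym x≢y y≡x = x≢y (sym y≡x)

WitnessedBy : ∀ {n} → State n → Label → (Fin n → Fin n → Set) → Fin n → Set
WitnessedBy {n} ℓ c Walk y = Σ (Fin n) λ x → Singleton ℓ x c × Walk x y

t0-trigger-walk : ∀ {n} {E : Arcs n} {ℓ : State n} {y} → Trigger E ℓ y t0 →
  WitnessedBy ℓ t0 (Walk01 E) y ⊎ WitnessedBy ℓ t1 (Walk11 E) y
t0-trigger-walk (rule2 x x≐t1 xy) = inj₂ (x , x≐t1 , segment-walk (arc xy))
t0-trigger-walk (rule3 {c = t0} x s y≢x x≐t0 (inj₁ (ys , xs))) =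
  inj₁ (x , x≐t0 , inj₁ (≢-sym y≢x , s , xs , ys))
t0-trigger-walk (rule3 {c = t0} x s y≢x x≐t0 (inj₂ (sy , sx))) =
  inj₁ (x , x≐t0 , inj₂ (two-segment-walk (arc sx) (arc sy)))

t1-trigger-walk : ∀ {n} {E : Arcs n} {ℓ : State n} {y} → Trigger E ℓ y t1 →
  WitnessedBy ℓ t0 (Walk00 E) y ⊎ WitnessedBy ℓ t1 (Walk10 E) y
t1-trigger-walk (rule1 x x≐t0 yx) = inj₁ (x , x≐t0 , segment-walk (arc yx))
t1-trigger-walk (rule3 {c = t1} x s y≢x x≐t1 (inj₁ (ys , xs))) =
  inj₂ (x , x≐t1 , inj₂ (two-segment-walk (arc xs) (arc ys)))
t1-trigger-walk (rule3 {c = t1} x s y≢x x≐t1 (inj₂ (sy , sx))) =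
  inj₂ (x , x≐t1 , inj₁ (≢-sym y≢x , s , sx , sy))

witnessed-during-run : ∀ {n} (σ : ℕ → State n) {m j} → j ≤ m →
  ∀ {c} Walk {y} → WitnessedBy (σ j) c Walk y →
  Σ (Fin n) λ x → Σ ℕ λ i → i ≤ m × Singleton (σ i) x c × Walk x y
witnessed-during-run σ {j = j} j≤m Walk (x , x≐c , walk) = x , j , j≤m , x≐c , walk

proposition4p4 : (n : ℕ) (E : Arcs n) → Irreflexive E → Oriented E → MaxDeg≤3 E →
    (σ : ℕ → State n) (m : ℕ) → IsRun E σ m →
    ((j : ℕ) (y : Fin n) → j < m → σ j y t0 ≡ true → σ (suc j) y t0 ≡ false →
      (Σ (Fin n) λ x → Σ ℕ λ i → i ≤ m × Singleton (σ i) x t0 × Walk01 E x y) ⊎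
      (Σ (Fin n) λ x → Σ ℕ λ i → i ≤ m × Singleton (σ i) x t1 × Walk11 E x y))
    ×
    ((j : ℕ) (y : Fin n) → j < m → σ j y t1 ≡ true → σ (suc j) y t1 ≡ false →
      (Σ (Fin n) λ x → Σ ℕ λ i → i ≤ m × Singleton (σ i) x t0 × Walk00 E x y) ⊎
      (Σ (Fin n) λ x → Σ ℕ λ i → i ≤ m × Singleton (σ i) x t1 × Walk10 E x y))
proposition4p4 n E _ _ _ σ m (_ , steps) =
  (λ j y j<m t0∈ t0∉ →
    Sum.map (witnessed-during-run σ (<⇒≤ j<m) (Walk01 E))
            (witnessed-during-run σ (<⇒≤ j<m) (Walk11 E))
      (t0-trigger-walk (step-removal-triggered (steps j j<m) t0∈ t0∉))) ,
  (λ j y j<m t1∈ t1∉ →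
    Sum.map (witnessed-during-run σ (<⇒≤ j<m) (Walk00 E))
            (witnessed-during-run σ (<⇒≤ j<m) (Walk10 E))
      (t1-trigger-walk (step-removal-triggered (steps j j<m) t1∈ t1∉)))
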